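{- Let $\lambda\in\mathbb{C}$ with $\lambda\neq 1$, let $r,k\in\mathbb{Z}$ and $n\ge 0$. Then \[ T_{n}^{(r,k)}(x|\lambda)=\sum_{m=0}^{n}\left\{ \sum_{l=0}^{n-m}(-1)^{l} \binom{n}{l+m} S_{2}(l+m,m)T_{n-m-l}^{(r,k)}(\lambda) \right\}x^{[m]}. \]
   Context: For $k\in\mathbb{Z}$, $Li_k(x)=\sum_{n\ge1}x^n/n^k$. For $r,k\in\mathbb{Z}$ the polynomials $T_n^{(r,k)}(x|\lambda)$ are defined by $\left(\frac{1-\lambda}{e^t-\lambda}\right)^r\frac{Li_{k}(1-e^{ -t})}{1-e^{ -t}}e^{xt}=\sum_{n\ge0}T_n^{(r,k)}(x|\lambda)\frac{t^n}{n!}$ (as formal power series in $t$), and $T_n^{(r,k)}(\lambda)=T_n^{(r,k)}(0|\lambda)$. $x^{[m]}=x(x+1)\cdots(x+m-1)$ is the rising factorial, and $S_2(l,m)$ denotes the Stirling numbers of the second kind, $(e^t-1)^m=m!\sum_{l\ge m}S_2(l,m)\frac{t^l}{l!}$. -}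

module Defs where

open import Algebra.Bundles using (CommutativeRing)
open import Data.Nat using (ℕ; zero; suc; _∸_; _!) renaming (_+_ to _+ℕ_; _*_ to _*ℕ_)
open import Data.Nat.Combinatorics using (_C_)
open import Data.Integer using (ℤ; +_; -[1+_])
open import Data.Fin using (Fin; toℕ)
open import Data.Vec using (Vec; []; _∷_; head; foldr; zipWith; tabulate)

S2 : ℕ → ℕ → ℕ
S2 zero    zero    = 1
S2 zero    (suc m) = 0
S2 (suc n) zero    = 0
S2 (suc n) (suc m) = suc m *ℕ S2 n (suc m) +ℕ S2 n m

module _ {c ℓ} (R : CommutativeRing c ℓ) where
  open CommutativeRing R

  nat : ℕ → Carrier
  nat zero    = 0#
  nat (suc n) = 1# + nat n

  pow : Carrier → ℕ → Carrier
  pow a zero    = 1#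
  pow a (suc n) = a * pow a n

  sumUpTo : ℕ → (ℕ → Carrier) → Carrier
  sumUpTo zero    f = 0#
  sumUpTo (suc n) f = sumUpTo n f + f n

  prodUpTo : ℕ → (ℕ → Carrier) → Carrier
  prodUpTo zero    f = 1#
  prodUpTo (suc n) f = prodUpTo n f * f n

  -- rising factorial x^[m] = x (x+1) ... (x+m-1)
  rising : Carrier → ℕ → Carrier
  rising x m = prodUpTo m (λ i → x + nat i)

  -- formal power series in t: sequence of (ordinary) coefficients
  Series : Set c
  Series = ℕ → Carrier

  constS : Carrier → Series
  constS a zero    = a
  constS a (suc n) = 0#

  scaleS : Carrier → Series → Series
  scaleS a f n = a * f n

  subS : Series → Series → Series
  subS f g n = f n - g n

  mulS : Series → Series → Series
  mulS f g n = sumUpTo (suc n) (λ i → f i * g (n ∸ i))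

  powS : Series → ℕ → Series
  powS f zero    = constS 1#
  powS f (suc n) = mulS f (powS f n)

  -- multiplicative inverse of a series f, given μ = (f 0)⁻¹:
  -- g 0 = μ,  g (n+1) = - μ * Σ_{j=1}^{n+1} f j * g (n+1-j).
  -- invVec f μ n = (g n , g (n-1) , ... , g 0)
  invVec : Series → Carrier → (n : ℕ) → Vec Carrier (suc n)
  invVec f μ zero    = μ ∷ []
  invVec f μ (suc n) =
    (- (μ * foldr (λ _ → Carrier) _+_ 0#
             (zipWith _*_ (tabulate (λ (i : Fin (suc n)) → f (suc (toℕ i)))) v)))
    ∷ v
    where v = invVec f μ n

  invS : Series → Carrier → Series
  invS f μ n = head (invVec f μ n)

  module _ (recip : ℕ → Carrier) where
    -- recip i is intended to be 1/(i+1); invFact n = 1/n!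
    invFact : ℕ → Carrier
    invFact n = prodUpTo n recip

    expS : Carrier → Series
    expS a n = pow a n * invFact n

    module _ (lam μ : Carrier) where
      -- μ is intended to be (1 - lam)⁻¹

      denS : Series
      denS = subS (expS 1#) (constS lam)

      factorPow : ℤ → Series
      factorPow (+ m)      = powS (scaleS (1# - lam) (invS denS μ)) m
      factorPow -[1+ m ]   = powS (scaleS μ denS) (suc m)

      uS : Series
      uS = subS (constS 1#) (expS (- 1#))

      invPowK : ℤ → ℕ → Carrier
      invPowK (+ m)     j = pow (recip (j ∸ 1)) m
      invPowK -[1+ m ]  j = pow (nat j) (suc m)

      -- Li_k(u)/u = Σ_{j≥1} u^{j-1} / j^k  (formal composition; only j ≤ n+1
      -- contribute to the coefficient of t^n since u has zero constant term)
      liS : ℤ → Series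
      liS k n = sumUpTo (suc n) (λ i → invPowK k (suc i) * powS uS i n)

      -- T_n^{(r,k)}(x|lam) = n! [t^n] ((1-lam)/(e^t-lam))^r Li_k(1-e^{-t})/(1-e^{-t}) e^{xt}
      T : ℤ → ℤ → Carrier → ℕ → Carrier
      T r k x n = nat (n !) * mulS (factorPow r) (mulS (liS k) (expS x)) n

      T0 : ℤ → ℤ → ℕ → Carrier
      T0 r k n = T r k 0# n

      theorem10RHS : ℤ → ℤ → Carrier → ℕ → Carrier
      theorem10RHS r k x n =
        sumUpTo (suc n) (λ m →
          sumUpTo (suc (n ∸ m)) (λ l →
            pow (- 1#) l * nat ((n C (l +ℕ m)) *ℕ S2 (l +ℕ m) m)
              * T0 r k (n ∸ m ∸ l))
          * rising x m)

{-# OPTIONS --safe #-}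
-- Expanding e^{xt} gives the Appell property
--   T_n(x|λ) = Σ_j C(n,j) T_{n-j}(λ) x^j,
-- valid for any power series in place of ((1-λ)/(e^t-λ))^r Li_k(1-e^{-t})/(1-e^{-t}).
-- Substituting x^j = Σ_m (-1)^{j-m} S₂(j,m) x^[m], obtained from x·x^[m] = x^[m+1] - m x^[m]
-- and the recurrence of S₂, and collecting the coefficient of x^[m] with j = l + m
-- gives the theorem.
module Submission where

open import Algebra.Bundles using (CommutativeRing)
import Algebra.Properties.CommutativeSemigroup as CommutativeSemigroupProperties
import Algebra.Properties.Ring as RingProperties
import Algebra.Solver.CommutativeMonoid as CommutativeMonoidSolver
open import Data.Fin using (#_)
open import Data.Integer using (ℤ)
open import Data.Nat using (ℕ; zero; suc; _∸_; _!; _<_; _≤_; s≤s) renaming (_+_ to _+ℕ_; _*_ to _*ℕ_)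
open import Data.Nat.Combinatorics using (_C_; nCk≡n!/k![n-k]!; k![n∸k]!∣n!)
open import Data.Nat.DivMod using (m/n*n≡m)
import Data.Nat.Properties as ℕₚ
open import Data.Sum using (inj₁; inj₂)
open import Data.Vec using ([]; _∷_)
open import Relation.Binary.PropositionalEquality as ≡ using (_≡_)
import Relation.Binary.Reasoning.Setoid as SetoidReasoning

open import Defs

S2-vanishes : ∀ {j m} → j < m → S2 j m ≡ 0
S2-vanishes {zero}  {suc m} _ = ≡.refl
S2-vanishes {suc j} {suc m} (s≤s j<m)
  rewrite S2-vanishes (ℕₚ.m<n⇒m<1+n j<m) | S2-vanishes j<m =
  ≡.trans (ℕₚ.+-identityʳ (m *ℕ 0)) (ℕₚ.*-zeroʳ m)

n!≡nCk*[k!*[n∸k]!] : ∀ {n k} → k ≤ n → n ! ≡ (n C k) *ℕ (k ! *ℕ (n ∸ k) !)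
n!≡nCk*[k!*[n∸k]!] {n} {k} k≤n =
  ≡.trans (≡.sym (m/n*n≡m {{ℕₚ._!*_!≢0 k (n ∸ k)}} (k![n∸k]!∣n! k≤n)))
          (≡.cong (_*ℕ (k ! *ℕ (n ∸ k) !)) (≡.sym (nCk≡n!/k![n-k]! k≤n)))

module _ {c ℓ} (R : CommutativeRing c ℓ) where
  open CommutativeRing R
  open SetoidReasoning setoid
  open RingProperties ring using (-‿distribˡ-*; -1*x≈-x; -0#≈0#)
  private
    module *ₚ = CommutativeSemigroupProperties *-commutativeSemigroup
    module +ₚ = CommutativeSemigroupProperties +-commutativeSemigroup
    open CommutativeMonoidSolver *-commutativeMonoid using (Expr; prove; var; _⊕_)

  Σ : ℕ → (ℕ → Carrier) → Carrier
  Σ = sumUpTo R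

  Σ-cong : ∀ n {f g : ℕ → Carrier} → (∀ i → i < n → f i ≈ g i) → Σ n f ≈ Σ n g
  Σ-cong zero    f≈g = refl
  Σ-cong (suc n) f≈g = +-cong (Σ-cong n λ i i<n → f≈g i (ℕₚ.m<n⇒m<1+n i<n)) (f≈g n (ℕₚ.n<1+n n))

  Σ-zero : ∀ n {f : ℕ → Carrier} → (∀ i → i < n → f i ≈ 0#) → Σ n f ≈ 0#
  Σ-zero zero    f≈0 = refl
  Σ-zero (suc n) f≈0 =
    trans (+-cong (Σ-zero n λ i i<n → f≈0 i (ℕₚ.m<n⇒m<1+n i<n)) (f≈0 n (ℕₚ.n<1+n n))) (+-identityʳ 0#)

  Σ-distrib-+ : ∀ n (f g : ℕ → Carrier) → Σ n (λ i → f i + g i) ≈ Σ n f + Σ n g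
  Σ-distrib-+ zero    f g = sym (+-identityʳ 0#)
  Σ-distrib-+ (suc n) f g = trans (+-congʳ (Σ-distrib-+ n f g)) (+ₚ.interchange _ _ _ _)

  *-distribˡ-Σ : ∀ n a (f : ℕ → Carrier) → a * Σ n f ≈ Σ n (λ i → a * f i)
  *-distribˡ-Σ zero    a f = zeroʳ a
  *-distribˡ-Σ (suc n) a f = trans (distribˡ a _ _) (+-congʳ (*-distribˡ-Σ n a f))

  *-distribʳ-Σ : ∀ n a (f : ℕ → Carrier) → Σ n f * a ≈ Σ n (λ i → f i * a)
  *-distribʳ-Σ zero    a f = zeroˡ a
  *-distribʳ-Σ (suc n) a f = trans (distribʳ a _ _) (+-congʳ (*-distribʳ-Σ n a f))

  Σ-head : ∀ n (f : ℕ → Carrier) → Σ (suc n) f ≈ f 0 + Σ n (λ i → f (suc i))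
  Σ-head zero    f = trans (+-identityˡ _) (sym (+-identityʳ _))
  Σ-head (suc n) f = trans (+-congʳ (Σ-head n f)) (+-assoc _ _ _)

  Σ-split : ∀ a b (f : ℕ → Carrier) → Σ (a +ℕ b) f ≈ Σ a f + Σ b (λ i → f (i +ℕ a))
  Σ-split a zero    f = trans (reflexive (≡.cong (λ n → Σ n f) (ℕₚ.+-identityʳ a))) (sym (+-identityʳ _))
  Σ-split a (suc b) f = begin
    Σ (a +ℕ suc b) f
      ≡⟨ ≡.cong (λ n → Σ n f) (ℕₚ.+-suc a b) ⟩
    Σ (a +ℕ b) f + f (a +ℕ b)
      ≈⟨ +-congʳ (Σ-split a b f) ⟩
    (Σ a f + Σ b (λ i → f (i +ℕ a))) + f (a +ℕ b)
      ≈⟨ +-assoc _ _ _ ⟩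
    Σ a f + (Σ b (λ i → f (i +ℕ a)) + f (a +ℕ b))
      ≡⟨ ≡.cong (λ j → Σ a f + (Σ b (λ i → f (i +ℕ a)) + f j)) (ℕₚ.+-comm a b) ⟩
    Σ a f + Σ (suc b) (λ i → f (i +ℕ a)) ∎

  Σ-reverse : ∀ n (f : ℕ → Carrier) → Σ (suc n) f ≈ Σ (suc n) (λ i → f (n ∸ i))
  Σ-reverse zero    f = refl
  Σ-reverse (suc n) f = begin
    Σ (suc n) f + f (suc n)                      ≈⟨ +-congʳ (Σ-reverse n f) ⟩
    Σ (suc n) (λ i → f (n ∸ i)) + f (suc n)      ≈⟨ +-comm _ _ ⟩
    f (suc n) + Σ (suc n) (λ i → f (n ∸ i))      ≈⟨ Σ-head (suc n) (λ i → f (suc n ∸ i)) ⟨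
    Σ (suc (suc n)) (λ i → f (suc n ∸ i))        ∎

  Σ-swap : ∀ m n (h : ℕ → ℕ → Carrier) → Σ m (λ i → Σ n (h i)) ≈ Σ n (λ j → Σ m (λ i → h i j))
  Σ-swap zero    n h = sym (Σ-zero n λ _ _ → refl)
  Σ-swap (suc m) n h = trans (+-congʳ (Σ-swap m n h)) (sym (Σ-distrib-+ n _ _))

  Σ-triangle : ∀ n (h : ℕ → ℕ → Carrier) →
    Σ (suc n) (λ i → Σ (suc (n ∸ i)) (h i)) ≈ Σ (suc n) (λ s → Σ (suc s) (λ i → h i (s ∸ i)))
  Σ-triangle zero    h = refl
  Σ-triangle (suc n) h = begin
    Σ (suc n) (λ i → Σ (suc (suc n ∸ i)) (h i)) + Σ (suc (n ∸ n)) (h (suc n))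
      ≈⟨ +-cong (Σ-cong (suc n) λ i i≤n →
                   reflexive (≡.cong (λ k → Σ (suc k) (h i)) (∸-suc (ℕₚ.≤-pred i≤n))))
                (reflexive (≡.cong (λ k → Σ (suc k) (h (suc n))) (ℕₚ.n∸n≡0 n))) ⟩
    Σ (suc n) (λ i → Σ (suc (n ∸ i)) (h i) + h i (suc (n ∸ i))) + (0# + h (suc n) 0)
      ≈⟨ +-cong (Σ-distrib-+ (suc n) _ _) (+-identityˡ _) ⟩
    (Σ (suc n) (λ i → Σ (suc (n ∸ i)) (h i)) + Σ (suc n) (λ i → h i (suc (n ∸ i)))) + h (suc n) 0
      ≈⟨ +-cong (+-cong (Σ-triangle n h) (Σ-cong (suc n) λ i i≤n →
                  reflexive (≡.cong (h i) (≡.sym (∸-suc (ℕₚ.≤-pred i≤n))))))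
                (reflexive (≡.cong (h (suc n)) (≡.sym (ℕₚ.n∸n≡0 n)))) ⟩
    (Σ (suc n) (λ s → Σ (suc s) (λ i → h i (s ∸ i))) + Σ (suc n) (λ i → h i (suc n ∸ i))) + h (suc n) (n ∸ n)
      ≈⟨ +-assoc _ _ _ ⟩
    Σ (suc n) (λ s → Σ (suc s) (λ i → h i (s ∸ i))) + Σ (suc (suc n)) (λ i → h i (suc n ∸ i)) ∎
    where
    ∸-suc : ∀ {i n} → i ≤ n → suc n ∸ i ≡ suc (n ∸ i)
    ∸-suc = ℕₚ.+-∸-assoc 1

  nat-+ : ∀ a b → nat R (a +ℕ b) ≈ nat R a + nat R b
  nat-+ zero    b = sym (+-identityˡ _)
  nat-+ (suc a) b = trans (+-congˡ (nat-+ a b)) (sym (+-assoc _ _ _))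

  nat-* : ∀ a b → nat R (a *ℕ b) ≈ nat R a * nat R b
  nat-* zero    b = sym (zeroˡ _)
  nat-* (suc a) b = begin
    nat R (b +ℕ a *ℕ b)                  ≈⟨ nat-+ b (a *ℕ b) ⟩
    nat R b + nat R (a *ℕ b)             ≈⟨ +-cong (sym (*-identityˡ _)) (nat-* a b) ⟩
    1# * nat R b + nat R a * nat R b     ≈⟨ distribʳ _ _ _ ⟨
    (1# + nat R a) * nat R b             ∎

  mulS-congʳ : ∀ (F : Series R) {G H : Series R} → (∀ i → G i ≈ H i) → ∀ n → mulS R F G n ≈ mulS R F H n
  mulS-congʳ F G≈H n = Σ-cong (suc n) λ i _ → *-congˡ (G≈H (n ∸ i))

  mulS-assoc : ∀ (F G H : Series R) n → mulS R F (mulS R G H) n ≈ mulS R (mulS R F G) H n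
  mulS-assoc F G H n = begin
    Σ (suc n) (λ i → F i * Σ (suc (n ∸ i)) (λ j → G j * H (n ∸ i ∸ j)))
      ≈⟨ Σ-cong (suc n) (λ i _ → *-distribˡ-Σ (suc (n ∸ i)) (F i) _) ⟩
    Σ (suc n) (λ i → Σ (suc (n ∸ i)) (λ j → F i * (G j * H (n ∸ i ∸ j))))
      ≈⟨ Σ-triangle n (λ i j → F i * (G j * H (n ∸ i ∸ j))) ⟩
    Σ (suc n) (λ s → Σ (suc s) (λ i → F i * (G (s ∸ i) * H (n ∸ i ∸ (s ∸ i)))))
      ≈⟨ Σ-cong (suc n) (λ s _ → Σ-cong (suc s) λ i i≤s →
           trans (sym (*-assoc _ _ _)) (*-congˡ (reflexive (≡.cong H (∸-∸-cancel (ℕₚ.≤-pred i≤s)))))) ⟩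
    Σ (suc n) (λ s → Σ (suc s) (λ i → (F i * G (s ∸ i)) * H (n ∸ s)))
      ≈⟨ Σ-cong (suc n) (λ s _ → *-distribʳ-Σ (suc s) _ _) ⟨
    Σ (suc n) (λ s → mulS R F G s * H (n ∸ s)) ∎
    where
    ∸-∸-cancel : ∀ {i s} → i ≤ s → n ∸ i ∸ (s ∸ i) ≡ n ∸ s
    ∸-∸-cancel {i} {s} i≤s = ≡.trans (ℕₚ.∸-+-assoc n i (s ∸ i)) (≡.cong (n ∸_) (ℕₚ.m+[n∸m]≡n i≤s))

  module _ (recip : ℕ → Carrier) (recip-inverse : ∀ i → nat R (suc i) * recip i ≈ 1#) where

    nat-!*invFact : ∀ n → nat R (n !) * invFact R recip n ≈ 1#
    nat-!*invFact zero    = trans (*-identityʳ _) (+-identityʳ 1#)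
    nat-!*invFact (suc n) = begin
      nat R (suc n *ℕ n !) * (invFact R recip n * recip n)          ≈⟨ *-cong (nat-* (suc n) (n !)) (*-comm _ _) ⟩
      (nat R (suc n) * nat R (n !)) * (recip n * invFact R recip n) ≈⟨ *ₚ.interchange _ _ _ _ ⟩
      (nat R (suc n) * recip n) * (nat R (n !) * invFact R recip n) ≈⟨ *-cong (recip-inverse n) (nat-!*invFact n) ⟩
      1# * 1#                                                       ≈⟨ *-identityʳ 1# ⟩
      1#                                                            ∎

    mulS-expS-0#-identityʳ : ∀ (F : Series R) n → mulS R F (expS R recip 0#) n ≈ F n
    mulS-expS-0#-identityʳ F n = begin
      Σ n (λ i → F i * expS R recip 0# (n ∸ i)) + F n * expS R recip 0# (n ∸ n)
        ≈⟨ +-cong (Σ-zero n λ i i<n → trans (*-congˡ (expS-0#-positive (ℕₚ.m<n⇒0<n∸m i<n))) (zeroʳ _))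
                  (*-congˡ (reflexive (≡.cong (expS R recip 0#) (ℕₚ.n∸n≡0 n)))) ⟩
      0# + F n * (1# * 1#)
        ≈⟨ trans (+-identityˡ _) (*-congˡ (*-identityʳ 1#)) ⟩
      F n * 1#
        ≈⟨ *-identityʳ _ ⟩
      F n ∎
      where
      expS-0#-positive : ∀ {m} → 0 < m → expS R recip 0# m ≈ 0#
      expS-0#-positive {suc m} _ = trans (*-congʳ (zeroˡ _)) (zeroˡ _)

    n!*mulS-expS≈binomial-Σ : ∀ (A : Series R) x n →
      nat R (n !) * mulS R A (expS R recip x) n
        ≈ Σ (suc n) (λ j → nat R (n C j) * (nat R ((n ∸ j) !) * A (n ∸ j)) * pow R x j)
    n!*mulS-expS≈binomial-Σ A x n = begin
      nat R (n !) * Σ (suc n) (λ s → A s * expS R recip x (n ∸ s))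
        ≈⟨ *-distribˡ-Σ (suc n) _ _ ⟩
      Σ (suc n) (λ s → nat R (n !) * (A s * expS R recip x (n ∸ s)))
        ≈⟨ Σ-reverse n _ ⟩
      Σ (suc n) (λ j → nat R (n !) * (A (n ∸ j) * expS R recip x (n ∸ (n ∸ j))))
        ≈⟨ Σ-cong (suc n) (λ j j≤n → term (ℕₚ.≤-pred j≤n)) ⟩
      Σ (suc n) (λ j → nat R (n C j) * (nat R ((n ∸ j) !) * A (n ∸ j)) * pow R x j) ∎
      where
      term : ∀ {j} → j ≤ n →
        nat R (n !) * (A (n ∸ j) * expS R recip x (n ∸ (n ∸ j)))
          ≈ nat R (n C j) * (nat R ((n ∸ j) !) * A (n ∸ j)) * pow R x j
      term {j} j≤n = begin
        nat R (n !) * (A (n ∸ j) * expS R recip x (n ∸ (n ∸ j)))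
          ≡⟨ ≡.cong₂ (λ k i → nat R k * (A (n ∸ j) * expS R recip x i))
                     (n!≡nCk*[k!*[n∸k]!] j≤n) (ℕₚ.m∸[m∸n]≡n j≤n) ⟩
        nat R ((n C j) *ℕ (j ! *ℕ (n ∸ j) !)) * (A (n ∸ j) * (pow R x j * invFact R recip j))
          ≈⟨ *-congʳ (trans (nat-* (n C j) _) (*-congˡ (nat-* (j !) _))) ⟩
        (B * (J * K)) * (A (n ∸ j) * (pow R x j * I))
          ≈⟨ rearrange B J K (A (n ∸ j)) (pow R x j) I ⟩
        (B * (K * A (n ∸ j)) * pow R x j) * (J * I)
          ≈⟨ trans (*-congˡ (nat-!*invFact j)) (*-identityʳ _) ⟩
        B * (K * A (n ∸ j)) * pow R x j ∎
        where
        B J K I : Carrier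
        B = nat R (n C j)
        J = nat R (j !)
        K = nat R ((n ∸ j) !)
        I = invFact R recip j
        rearrange : ∀ c j k a x i → (c * (j * k)) * (a * (x * i)) ≈ ((c * (k * a)) * x) * (j * i)
        rearrange c j k a x i =
          prove 6 ((c′ ⊕ (j′ ⊕ k′)) ⊕ (a′ ⊕ (x′ ⊕ i′))) (((c′ ⊕ (k′ ⊕ a′)) ⊕ x′) ⊕ (j′ ⊕ i′))
                  (c ∷ j ∷ k ∷ a ∷ x ∷ i ∷ [])
          where
          c′ j′ k′ a′ x′ i′ : Expr 6
          c′ = var (# 0); j′ = var (# 1); k′ = var (# 2); a′ = var (# 3); x′ = var (# 4); i′ = var (# 5)

    T-binomial : ∀ lam μ r k x n →
      T R recip lam μ r k x n ≈ Σ (suc n) (λ j → nat R (n C j) * T0 R recip lam μ r k (n ∸ j) * pow R x j)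
    T-binomial lam μ r k x n = begin
      nat R (n !) * mulS R F (mulS R G (expS R recip x)) n
        ≈⟨ *-congˡ (mulS-assoc F G (expS R recip x) n) ⟩
      nat R (n !) * mulS R (mulS R F G) (expS R recip x) n
        ≈⟨ n!*mulS-expS≈binomial-Σ (mulS R F G) x n ⟩
      Σ (suc n) (λ j → nat R (n C j) * (nat R ((n ∸ j) !) * mulS R F G (n ∸ j)) * pow R x j)
        ≈⟨ Σ-cong (suc n) (λ j _ → *-congʳ (*-congˡ (*-congˡ
             (mulS-congʳ F (λ i → sym (mulS-expS-0#-identityʳ G i)) (n ∸ j))))) ⟩
      Σ (suc n) (λ j → nat R (n C j) * T0 R recip lam μ r k (n ∸ j) * pow R x j) ∎
      where
      F G : Series R
      F = factorPow R recip lam μ r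
      G = liS R recip lam μ k

  signedS2 : ℕ → ℕ → Carrier
  signedS2 j m = pow R (- 1#) (j ∸ m) * nat R (S2 j m)

  signedS2-vanishes : ∀ {j m} → j < m → signedS2 j m ≈ 0#
  signedS2-vanishes j<m = trans (*-congˡ (reflexive (≡.cong (nat R) (S2-vanishes j<m)))) (zeroʳ _)

  -- For j ≤ m both sides vanish, so the truncated subtraction in the exponent is harmless.
  -signedS2-suc : ∀ j m → - signedS2 j (suc m) ≈ pow R (- 1#) (j ∸ m) * nat R (S2 j (suc m))
  -signedS2-suc j m with ℕₚ.<-≤-connex m j
  ... | inj₁ m<j = begin
    - (pow R (- 1#) (j ∸ suc m) * nat R (S2 j (suc m)))
      ≈⟨ -‿distribˡ-* _ _ ⟩
    - pow R (- 1#) (j ∸ suc m) * nat R (S2 j (suc m))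
      ≈⟨ *-congʳ (-1*x≈-x _) ⟨
    pow R (- 1#) (suc (j ∸ suc m)) * nat R (S2 j (suc m))
      ≡⟨ ≡.cong (λ e → pow R (- 1#) e * nat R (S2 j (suc m))) (≡.sym (ℕₚ.+-∸-assoc 1 m<j)) ⟩
    pow R (- 1#) (j ∸ m) * nat R (S2 j (suc m)) ∎
  ... | inj₂ j≤m = trans (trans (-‿cong (signedS2-vanishes (s≤s j≤m))) -0#≈0#)
                         (sym (trans (*-congˡ (reflexive (≡.cong (nat R) (S2-vanishes (s≤s j≤m))))) (zeroʳ _)))

  signedS2-suc-suc : ∀ j m → signedS2 (suc j) (suc m) ≈ signedS2 j m - signedS2 j (suc m) * nat R (suc m)
  signedS2-suc-suc j m = begin
    p * nat R (suc m *ℕ S2 j (suc m) +ℕ S2 j m)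
      ≈⟨ *-congˡ (trans (nat-+ (suc m *ℕ S2 j (suc m)) (S2 j m)) (+-congʳ (nat-* (suc m) (S2 j (suc m))))) ⟩
    p * (M * A + B)
      ≈⟨ trans (distribˡ _ _ _) (+-comm _ _) ⟩
    p * B + p * (M * A)
      ≈⟨ +-congˡ (*ₚ.x∙yz≈xz∙y _ _ _) ⟩
    signedS2 j m + (p * A) * M
      ≈⟨ +-congˡ (*-congʳ (-signedS2-suc j m)) ⟨
    signedS2 j m + (- signedS2 j (suc m)) * M
      ≈⟨ +-congˡ (-‿distribˡ-* _ _) ⟨
    signedS2 j m - signedS2 j (suc m) * M ∎
    where
    p A B M : Carrier
    p = pow R (- 1#) (j ∸ m)
    A = nat R (S2 j (suc m))
    B = nat R (S2 j m)
    M = nat R (suc m)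

  module _ (x : Carrier) where

    ρ : ℕ → Carrier
    ρ = rising R x

    x*rising : ∀ a m → x * (a * ρ m) ≈ a * ρ (suc m) - (a * nat R m) * ρ m
    x*rising a m = sym (begin
      a * (ρ m * (x + nat R m)) - (a * nat R m) * ρ m
        ≈⟨ +-cong (*-congˡ (distribˡ _ _ _)) (-‿cong (*ₚ.xy∙z≈x∙zy _ _ _)) ⟩
      a * (ρ m * x + ρ m * nat R m) - a * (ρ m * nat R m)
        ≈⟨ +-congʳ (distribˡ _ _ _) ⟩
      (a * (ρ m * x) + a * (ρ m * nat R m)) - a * (ρ m * nat R m)
        ≈⟨ +-assoc _ _ _ ⟩
      a * (ρ m * x) + (a * (ρ m * nat R m) - a * (ρ m * nat R m))
        ≈⟨ +-cong (*ₚ.x∙yz≈y∙xz _ _ _) (-‿inverseʳ _) ⟩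
      ρ m * (a * x) + 0#
        ≈⟨ +-identityʳ _ ⟩
      ρ m * (a * x)
        ≈⟨ *ₚ.x∙yz≈zy∙x _ _ _ ⟩
      (x * a) * ρ m
        ≈⟨ *-assoc _ _ _ ⟩
      x * (a * ρ m) ∎)

    pow≈Σ-signedS2-rising : ∀ j N → j < N → pow R x j ≈ Σ N (λ m → signedS2 j m * ρ m)
    pow≈Σ-signedS2-rising zero (suc N) _ = sym (begin
      Σ (suc N) (λ m → signedS2 0 m * ρ m)
        ≈⟨ Σ-head N _ ⟩
      signedS2 0 0 * ρ 0 + Σ N (λ m → signedS2 0 (suc m) * ρ (suc m))
        ≈⟨ +-congˡ (Σ-zero N λ m _ → trans (*-congʳ (signedS2-vanishes (ℕₚ.0<1+n {m}))) (zeroˡ _)) ⟩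
      (1# * (1# + 0#)) * 1# + 0#
        ≈⟨ trans (+-identityʳ _) (trans (*-identityʳ _) (trans (*-identityˡ _) (+-identityʳ _))) ⟩
      1# ∎)
    pow≈Σ-signedS2-rising (suc j) (suc N) (s≤s j<N) = begin
      x * pow R x j
        ≈⟨ *-congˡ (pow≈Σ-signedS2-rising j (suc N) (ℕₚ.m<n⇒m<1+n j<N)) ⟩
      x * Σ (suc N) (λ m → σ m * ρ m)
        ≈⟨ trans (*-distribˡ-Σ (suc N) x _) (Σ-cong (suc N) λ m _ → x*rising (σ m) m) ⟩
      Σ (suc N) (λ m → σ m * ρ (suc m) - (σ m * nat R m) * ρ m)
        ≈⟨ Σ-distrib-+ (suc N) _ _ ⟩
      Σ (suc N) (λ m → σ m * ρ (suc m)) + Σ (suc N) (λ m → - ((σ m * nat R m) * ρ m))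
        ≈⟨ +-cong dropLast dropFirst ⟩
      Σ N (λ m → σ m * ρ (suc m)) + Σ N (λ m → - ((σ (suc m) * nat R (suc m)) * ρ (suc m)))
        ≈⟨ Σ-distrib-+ N _ _ ⟨
      Σ N (λ m → σ m * ρ (suc m) - (σ (suc m) * nat R (suc m)) * ρ (suc m))
        ≈⟨ Σ-cong N (λ m _ → trans (+-congˡ (-‿distribˡ-* _ _)) (sym (distribʳ _ _ _))) ⟩
      Σ N (λ m → (σ m - σ (suc m) * nat R (suc m)) * ρ (suc m))
        ≈⟨ Σ-cong N (λ m _ → *-congʳ (sym (signedS2-suc-suc j m))) ⟩
      Σ N (λ m → signedS2 (suc j) (suc m) * ρ (suc m))
        ≈⟨ trans (sym (+-identityˡ _)) (+-congʳ (sym (trans (*-congʳ (zeroʳ _)) (zeroˡ _)))) ⟩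
      signedS2 (suc j) 0 * ρ 0 + Σ N (λ m → signedS2 (suc j) (suc m) * ρ (suc m))
        ≈⟨ Σ-head N _ ⟨
      Σ (suc N) (λ m → signedS2 (suc j) m * ρ m) ∎
      where
      σ : ℕ → Carrier
      σ = signedS2 j

      dropLast : Σ (suc N) (λ m → σ m * ρ (suc m)) ≈ Σ N (λ m → σ m * ρ (suc m))
      dropLast = trans (+-congˡ (trans (*-congʳ (signedS2-vanishes j<N)) (zeroˡ _))) (+-identityʳ _)
      dropFirst : Σ (suc N) (λ m → - ((σ m * nat R m) * ρ m))
                    ≈ Σ N (λ m → - ((σ (suc m) * nat R (suc m)) * ρ (suc m)))
      dropFirst = trans (Σ-head N _)
        (trans (+-congʳ (trans (-‿cong (trans (*-congʳ (zeroʳ _)) (zeroˡ _))) -0#≈0#)) (+-identityˡ _))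

    binomial-Σ≈Σ-rising : ∀ (a : ℕ → Carrier) n →
      Σ (suc n) (λ j → nat R (n C j) * a (n ∸ j) * pow R x j)
        ≈ Σ (suc n) (λ m →
            Σ (suc (n ∸ m)) (λ l → pow R (- 1#) l * nat R ((n C (l +ℕ m)) *ℕ S2 (l +ℕ m) m) * a (n ∸ m ∸ l))
            * ρ m)
    binomial-Σ≈Σ-rising a n = begin
      Σ (suc n) (λ j → b j * pow R x j)
        ≈⟨ Σ-cong (suc n) (λ j j≤n → *-congˡ (pow≈Σ-signedS2-rising j (suc n) j≤n)) ⟩
      Σ (suc n) (λ j → b j * Σ (suc n) (λ m → signedS2 j m * ρ m))
        ≈⟨ Σ-cong (suc n) (λ j _ → *-distribˡ-Σ (suc n) _ _) ⟩
      Σ (suc n) (λ j → Σ (suc n) (λ m → b j * (signedS2 j m * ρ m)))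
        ≈⟨ Σ-swap (suc n) (suc n) _ ⟩
      Σ (suc n) (λ m → Σ (suc n) (λ j → b j * (signedS2 j m * ρ m)))
        ≈⟨ Σ-cong (suc n) (λ m m≤n → column (ℕₚ.≤-pred m≤n)) ⟩
      Σ (suc n) (λ m → Σ (suc (n ∸ m)) (coefficient m) * ρ m) ∎
      where
      b : ℕ → Carrier
      b j = nat R (n C j) * a (n ∸ j)

      coefficient : ℕ → ℕ → Carrier
      coefficient m l = pow R (- 1#) l * nat R ((n C (l +ℕ m)) *ℕ S2 (l +ℕ m) m) * a (n ∸ m ∸ l)

      term : ∀ m l → b (l +ℕ m) * (signedS2 (l +ℕ m) m * ρ m) ≈ coefficient m l * ρ m
      term m l = begin
        (B * a (n ∸ (l +ℕ m))) * ((pow R (- 1#) (l +ℕ m ∸ m) * S) * ρ m)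
          ≡⟨ ≡.cong₂ (λ i e → (B * a i) * ((pow R (- 1#) e * S) * ρ m))
                     (≡.trans (≡.cong (n ∸_) (ℕₚ.+-comm l m)) (≡.sym (ℕₚ.∸-+-assoc n m l)))
                     (ℕₚ.m+n∸n≡m l m) ⟩
        (B * a (n ∸ m ∸ l)) * ((pow R (- 1#) l * S) * ρ m)
          ≈⟨ rearrange B (a (n ∸ m ∸ l)) (pow R (- 1#) l) S (ρ m) ⟩
        (pow R (- 1#) l * (B * S) * a (n ∸ m ∸ l)) * ρ m
          ≈⟨ *-congʳ (*-congʳ (*-congˡ (sym (nat-* (n C (l +ℕ m)) _)))) ⟩
        coefficient m l * ρ m ∎
        where
        B S : Carrier
        B = nat R (n C (l +ℕ m))
        S = nat R (S2 (l +ℕ m) m)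
        rearrange : ∀ c a s t r → (c * a) * ((s * t) * r) ≈ ((s * (c * t)) * a) * r
        rearrange c a s t r =
          prove 5 ((c′ ⊕ a′) ⊕ ((s′ ⊕ t′) ⊕ r′)) (((s′ ⊕ (c′ ⊕ t′)) ⊕ a′) ⊕ r′)
                  (c ∷ a ∷ s ∷ t ∷ r ∷ [])
          where
          c′ a′ s′ t′ r′ : Expr 5
          c′ = var (# 0); a′ = var (# 1); s′ = var (# 2); t′ = var (# 3); r′ = var (# 4)

      column : ∀ {m} → m ≤ n →
        Σ (suc n) (λ j → b j * (signedS2 j m * ρ m)) ≈ Σ (suc (n ∸ m)) (coefficient m) * ρ m
      column {m} m≤n = begin
        Σ (suc n) f
          ≡⟨ ≡.cong (λ k → Σ k f) (≡.sym (≡.trans (ℕₚ.+-suc m (n ∸ m)) (≡.cong suc (ℕₚ.m+[n∸m]≡n m≤n)))) ⟩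
        Σ (m +ℕ suc (n ∸ m)) f
          ≈⟨ Σ-split m (suc (n ∸ m)) f ⟩
        Σ m f + Σ (suc (n ∸ m)) (λ l → f (l +ℕ m))
          ≈⟨ +-congʳ (Σ-zero m λ j j<m →
               trans (*-congˡ (trans (*-congʳ (signedS2-vanishes j<m)) (zeroˡ _))) (zeroʳ _)) ⟩
        0# + Σ (suc (n ∸ m)) (λ l → f (l +ℕ m))
          ≈⟨ trans (+-identityˡ _) (Σ-cong (suc (n ∸ m)) λ l _ → term m l) ⟩
        Σ (suc (n ∸ m)) (λ l → coefficient m l * ρ m)
          ≈⟨ *-distribʳ-Σ (suc (n ∸ m)) _ _ ⟨
        Σ (suc (n ∸ m)) (coefficient m) * ρ m ∎
        where
        f : ℕ → Carrier
        f j = b j * (signedS2 j m * ρ m)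

theorem10 : ∀ {c ℓ} (R : CommutativeRing c ℓ) →
    let open CommutativeRing R in
    (recip : ℕ → Carrier) → (∀ i → nat R (suc i) * recip i ≈ 1#) →
    (lam μ : Carrier) → (1# - lam) * μ ≈ 1# →
    (r k : ℤ) (n : ℕ) (x : Carrier) →
    T R recip lam μ r k x n ≈ theorem10RHS R recip lam μ r k x n
theorem10 R recip recip-inverse lam μ _ r k n x =
  trans (T-binomial R recip recip-inverse lam μ r k x n)
        (binomial-Σ≈Σ-rising R x (T0 R recip lam μ r k) n)
  where open CommutativeRing R using (trans)
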